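{- Let $m\geq 5$ be an integer and let $X=\{x_1,\ldots,x_m\}$ and $Y=\{y_1,\ldots,y_m\}$ be disjoint sets of size $m$. Then there exists a two-sided intersecting family $\mathcal{F}\subseteq\binom{X,Y}{2,2}$ with $|\mathcal{F}|\geq 3m^2-10m+10$.
   Context: For disjoint sets $X_1,X_2$ and integers $k,\ell$, $\binom{X_1,X_2}{k,\ell}$ denotes the family of all sets $S\subseteq X_1\cup X_2$ with $|S\cap X_1|=k$ and $|S\cap X_2|=\ell$. A family $\mathcal{F}$ is intersecting if every two members of $\mathcal{F}$ have nonempty intersection. A family $\mathcal{F}\subseteq\binom{X_1,X_2}{k,\ell}$ is two-sided intersecting if it is intersecting and there exist members $F_{11},F_{12},F_{21},F_{22}\in\mathcal{F}$ with $F_{11}\cap F_{12}\cap X_1=\emptyset$ and $F_{21}\cap F_{22}\cap X_2=\emptyset$. -}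

module Defs where

open import Data.Nat using (ℕ)
open import Data.Product using (_×_; proj₁; proj₂; Σ-syntax)
open import Data.Sum using (_⊎_)
open import Data.Fin.Subset using (Subset; _∩_; ∣_∣; Nonempty; Empty)
open import Data.List using (List)
open import Data.List.Membership.Propositional using (_∈_)
open import Relation.Binary.PropositionalEquality using (_≡_)

-- A subset S of X ⊎ Y, where X = Y = Fin m (disjoint copies via ⊎),
-- represented by its two traces (S ∩ X , S ∩ Y).
BiSet : ℕ → Set
BiSet m = Subset m × Subset m

InBinom : ∀ {m} → ℕ → ℕ → BiSet m → Set
InBinom k l S = ∣ proj₁ S ∣ ≡ k × ∣ proj₂ S ∣ ≡ l

Meets : ∀ {m} → BiSet m → BiSet m → Set
Meets S T = Nonempty (proj₁ S ∩ proj₁ T) ⊎ Nonempty (proj₂ S ∩ proj₂ T)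

-- A family is a list of BiSets (size counted when the list is duplicate-free)
Intersecting : ∀ {m} → List (BiSet m) → Set
Intersecting 𝓕 = ∀ {S T} → S ∈ 𝓕 → T ∈ 𝓕 → Meets S T

TwoSidedIntersecting : ∀ {m} → List (BiSet m) → Set
TwoSidedIntersecting 𝓕 =
  Intersecting 𝓕
  × (Σ[ F₁₁ ∈ _ ] Σ[ F₁₂ ∈ _ ] (F₁₁ ∈ 𝓕 × F₁₂ ∈ 𝓕 × Empty (proj₁ F₁₁ ∩ proj₁ F₁₂)))
  × (Σ[ F₂₁ ∈ _ ] Σ[ F₂₂ ∈ _ ] (F₂₁ ∈ 𝓕 × F₂₂ ∈ 𝓕 × Empty (proj₂ F₂₁ ∩ proj₂ F₂₂)))

module Submission where

open import Defs
open import Data.Nat using (ℕ; _≤_; _+_; _*_; _∸_)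
open import Data.Product using (Σ-syntax; _×_)
open import Data.List using (List; length)
open import Data.List.Relation.Unary.All using (All)
open import Data.List.Relation.Unary.Unique.Propositional using (Unique)

-- Write X = {x0, x1, ...} and Y = {y0, y1, ...}.  The family is
--   F = {core} ∪ A ∪ B,  core = {x1, x2, y0, y1},
--   A = {x0x1, x0x2} × (all pairs of Y),
--   B = {x0xi : i ≥ 3} × (pairs of Y meeting {y0, y1}).
-- Every member of A ∪ B contains x0 (a star), and meets the core: members of
-- A through x1 or x2, members of B through y0 or y1; hence F is intersecting.
-- It is two-sided: core and (x0x3, y0y1) are disjoint on X, while
-- (x0x1, y0y1) and (x0x1, y2y3) are disjoint on Y.  Its size is
--   1 + 2·C(m,2) + (m−3)(2m−3) = 3m² − 10m + 10.

open import Data.Nat using (zero; suc; s≤s)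
open import Data.Nat.Properties using (≤-reflexive)
open import Data.Nat.Tactic.RingSolver using (solve-∀)
open import Data.Bool using (true; false)
open import Data.Vec using (_∷_)
import Data.Vec as Vec
open import Data.Vec.Properties using (∷-injectiveʳ)
open import Data.Fin using (Fin) renaming (zero to fz; suc to fs)
open import Data.Fin.Subset using (Subset; ⊥; _∩_; ∣_∣; Nonempty; Empty; _∈_; _∉_)
open import Data.Fin.Subset.Properties using (∣⊥∣≡0; ∉⊥; x∈p∩q⁺; ∩-comm; ∩-zeroˡ)
open import Data.Product using (_,_; proj₁; proj₂)
open import Data.Sum using (_⊎_; inj₁; inj₂)
open import Data.List using ([]; _∷_; map; _++_; cartesianProduct)
open import Data.List.Properties using (length-++; length-map)
open import Data.List.Membership.Propositional using () renaming (_∈_ to _∈ₗ_)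
open import Data.List.Membership.Propositional.Properties
  using (∈-map⁺; ∈-map⁻; ∈-++⁺ˡ; ∈-++⁺ʳ; ∈-++⁻; ∈-cartesianProduct⁺; ∈-cartesianProduct⁻)
open import Data.List.Relation.Unary.Any using (here; there)
import Data.List.Relation.Unary.All as All
open import Data.List.Relation.Unary.All using ([]; _∷_)
import Data.List.Relation.Unary.All.Properties as AllP
import Data.List.Relation.Unary.Unique.Propositional.Properties as UniqueP
open import Data.List.Relation.Unary.AllPairs using ([]; _∷_)
open import Data.List.Relation.Binary.Disjoint.Propositional using (Disjoint)
open import Function using (_∘_)
open import Relation.Binary.PropositionalEquality

singletons : (n : ℕ) → List (Subset n)
singletons zero    = []
singletons (suc n) = (true ∷ ⊥) ∷ map (false ∷_) (singletons n)

pairs : (n : ℕ) → List (Subset n)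
pairs zero    = []
pairs (suc n) = map (true ∷_) (singletons n) ++ map (false ∷_) (pairs n)

unique-map-cons : ∀ {n} b {xs : List (Subset n)} → Unique xs → Unique (map (b ∷_) xs)
unique-map-cons b = UniqueP.map⁺ ∷-injectiveʳ

disjoint-map-cons : ∀ {n} (xs ys : List (Subset n)) → Disjoint (map (true ∷_) xs) (map (false ∷_) ys)
disjoint-map-cons xs ys (p , q) with ∈-map⁻ (true ∷_) p | ∈-map⁻ (false ∷_) q
... | _ , _ , refl | _ , _ , ()

singletons-unique : ∀ n → Unique (singletons n)
singletons-unique zero    = []
singletons-unique (suc n) =
  AllP.¬Any⇒All¬ _ (λ p → disjoint-map-cons (⊥ ∷ []) (singletons n) (here refl , p))
  ∷ unique-map-cons false (singletons-unique n)

pairs-unique : ∀ n → Unique (pairs n)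
pairs-unique zero    = []
pairs-unique (suc n) =
  UniqueP.++⁺ (unique-map-cons true (singletons-unique n)) (unique-map-cons false (pairs-unique n))
              (disjoint-map-cons (singletons n) (pairs n))

singleton-size : ∀ {n} {s : Subset n} → s ∈ₗ singletons n → ∣ s ∣ ≡ 1
singleton-size {suc n} (here refl) = cong suc (∣⊥∣≡0 n)
singleton-size {suc n} (there p) with ∈-map⁻ (false ∷_) p
... | _ , q , refl = singleton-size q

pair-size : ∀ {n} {s : Subset n} → s ∈ₗ pairs n → ∣ s ∣ ≡ 2
pair-size {suc n} p with ∈-++⁻ (map (true ∷_) (singletons n)) p
... | inj₁ q with ∈-map⁻ (true ∷_) q
...   | _ , r , refl = cong suc (singleton-size r)
pair-size {suc n} p | inj₂ q with ∈-map⁻ (false ∷_) q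
...   | _ , r , refl = pair-size r

∈-pairs-head : ∀ {n} {s : Subset n} → s ∈ₗ singletons n → (true ∷ s) ∈ₗ pairs (suc n)
∈-pairs-head p = ∈-++⁺ˡ (∈-map⁺ (true ∷_) p)

∈-pairs-tail : ∀ {n} {s : Subset n} → s ∈ₗ pairs n → (false ∷ s) ∈ₗ pairs (suc n)
∈-pairs-tail {n} p = ∈-++⁺ʳ (map (true ∷_) (singletons n)) (∈-map⁺ (false ∷_) p)

singletons-length : ∀ n → length (singletons n) ≡ n
singletons-length zero    = refl
singletons-length (suc n) = cong suc (trans (length-map (false ∷_) (singletons n)) (singletons-length n))

-- 2·C(n,2) + n = n², i.e. Fin n has C(n,2) two-element subsets.
pairs-length : ∀ n → 2 * length (pairs n) + n ≡ n * n
pairs-length zero    = refl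
pairs-length (suc n) = begin
    2 * length (pairs (suc n)) + suc n  ≡⟨ cong (λ l → 2 * l + suc n) length-split ⟩
    2 * (n + P) + suc n                 ≡⟨ regroup n P ⟩
    (2 * P + n) + (2 * n + 1)           ≡⟨ cong (_+ (2 * n + 1)) (pairs-length n) ⟩
    n * n + (2 * n + 1)                 ≡⟨ square-suc n ⟩
    suc n * suc n                       ∎
  where
  open ≡-Reasoning
  P = length (pairs n)
  length-split : length (pairs (suc n)) ≡ n + P
  length-split = trans (length-++ (map (true ∷_) (singletons n)))
    (cong₂ _+_ (trans (length-map (true ∷_) (singletons n)) (singletons-length n))
               (length-map (false ∷_) (pairs n)))
  regroup : ∀ n p → 2 * (n + p) + suc n ≡ (2 * p + n) + (2 * n + 1)
  regroup = solve-∀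
  square-suc : ∀ n → n * n + (2 * n + 1) ≡ suc n * suc n
  square-suc = solve-∀

length-cartesianProduct : ∀ {A B : Set} (xs : List A) (ys : List B) →
  length (cartesianProduct xs ys) ≡ length xs * length ys
length-cartesianProduct []       ys = refl
length-cartesianProduct (x ∷ xs) ys = trans (length-++ (map (x ,_) ys))
  (cong₂ _+_ (length-map (x ,_) ys) (length-cartesianProduct xs ys))

∈-cartesianProduct-elim : ∀ {A B : Set} {P : A → Set} {Q : B → Set} {xs ys} →
  (∀ {x} → x ∈ₗ xs → P x) → (∀ {y} → y ∈ₗ ys → Q y) →
  ∀ {S} → S ∈ₗ cartesianProduct xs ys → P (proj₁ S) × Q (proj₂ S)
∈-cartesianProduct-elim {xs = xs} {ys} onX onY p =
  let x∈ , y∈ = ∈-cartesianProduct⁻ xs ys p in onX x∈ , onY y∈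

disjoint-cartesianProduct : ∀ {A B : Set} {xs xs' : List A} (ys ys' : List B) →
  Disjoint xs xs' → Disjoint (cartesianProduct xs ys) (cartesianProduct xs' ys')
disjoint-cartesianProduct {xs = xs} {xs'} ys ys' xs#xs' (p , q) =
  xs#xs' (proj₁ (∈-cartesianProduct⁻ xs ys p) , proj₁ (∈-cartesianProduct⁻ xs' ys' q))

meet-at : ∀ {n} {p q : Subset n} (i : Fin n) → i ∈ p → i ∈ q → Nonempty (p ∩ q)
meet-at i i∈p i∈q = i , x∈p∩q⁺ (i∈p , i∈q)

meets-sym : ∀ {m} {S T : BiSet m} → Meets S T → Meets T S
meets-sym {S = p , _} {q , _} (inj₁ ne) = inj₁ (subst Nonempty (∩-comm p q) ne)
meets-sym {S = _ , p} {_ , q} (inj₂ ne) = inj₂ (subst Nonempty (∩-comm p q) ne)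

empty-if-⊥ : ∀ {n} {p : Subset n} → p ≡ ⊥ → Empty p
empty-if-⊥ refl (x , x∈⊥) = ∉⊥ x∈⊥

module StarPlusOne {m} (c : Fin m) (e : BiSet m) (star : List (BiSet m))
  (member : ∀ {S} → S ∈ₗ star → c ∈ proj₁ S × Meets e S) where

  intersecting : Meets e e → Intersecting (e ∷ star)
  intersecting e-e (here refl) (here refl) = e-e
  intersecting _   (here refl) (there q)   = proj₂ (member q)
  intersecting _   (there p)   (here refl) = meets-sym (proj₂ (member p))
  intersecting _   (there p)   (there q)   =
    inj₁ (meet-at c (proj₁ (member p)) (proj₁ (member q)))

  unique : c ∉ proj₁ e → Unique star → Unique (e ∷ star)
  unique c∉e star! = AllP.¬Any⇒All¬ star (λ e∈ → c∉e (proj₁ (member e∈))) ∷ star!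

module Construction (k : ℕ) where

  M : ℕ
  M = 4 + k

  x0x1 x0x2 : Subset M
  x0x1 = true ∷ true ∷ false ∷ ⊥
  x0x2 = true ∷ false ∷ true ∷ ⊥

  farPairs : List (Subset M)
  farPairs = map (λ s → true ∷ false ∷ false ∷ s) (singletons (1 + k))

  -- The pairs of Y meeting {y0, y1}: {y0, yj} with j ≥ 1, then {y1, yj} with j ≥ 2.
  nearPairs : List (Subset M)
  nearPairs = map (true ∷_) (singletons (3 + k)) ++ map (false ∷_) (map (true ∷_) (singletons (2 + k)))

  core : BiSet M
  core = false ∷ true ∷ true ∷ ⊥ , true ∷ true ∷ ⊥

  A B : List (BiSet M)
  A = cartesianProduct (x0x1 ∷ x0x2 ∷ []) (pairs M)
  B = cartesianProduct farPairs nearPairs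

  family : List (BiSet M)
  family = core ∷ A ++ B

  meets-core-X : ∀ {x} → fs fz ∈ x ⊎ fs (fs fz) ∈ x → Nonempty (proj₁ core ∩ x)
  meets-core-X (inj₁ x1∈) = meet-at (fs fz) (Vec.there Vec.here) x1∈
  meets-core-X (inj₂ x2∈) = meet-at (fs (fs fz)) (Vec.there (Vec.there Vec.here)) x2∈

  meets-core-Y : ∀ {y} → fz ∈ y ⊎ fs fz ∈ y → Nonempty (proj₂ core ∩ y)
  meets-core-Y (inj₁ y0∈) = meet-at fz Vec.here y0∈
  meets-core-Y (inj₂ y1∈) = meet-at (fs fz) (Vec.there Vec.here) y1∈

  close-member : ∀ {x} → x ∈ₗ (x0x1 ∷ x0x2 ∷ []) → ∣ x ∣ ≡ 2 × fz ∈ x × (fs fz ∈ x ⊎ fs (fs fz) ∈ x)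
  close-member (here refl)         = cong (suc ∘ suc) (∣⊥∣≡0 (2 + k)) , Vec.here , inj₁ (Vec.there Vec.here)
  close-member (there (here refl)) = cong (suc ∘ suc) (∣⊥∣≡0 (2 + k)) , Vec.here , inj₂ (Vec.there (Vec.there Vec.here))

  far-member : ∀ {x} → x ∈ₗ farPairs → ∣ x ∣ ≡ 2 × fz ∈ x
  far-member p with ∈-map⁻ (λ s → true ∷ false ∷ false ∷ s) p
  ... | _ , q , refl = cong suc (singleton-size q) , Vec.here

  near-member : ∀ {y} → y ∈ₗ nearPairs → ∣ y ∣ ≡ 2 × (fz ∈ y ⊎ fs fz ∈ y)
  near-member p with ∈-++⁻ (map (true ∷_) (singletons (3 + k))) p
  ... | inj₁ q with ∈-map⁻ (true ∷_) q
  ...   | _ , r , refl = cong suc (singleton-size r) , inj₁ Vec.here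
  near-member p | inj₂ q with ∈-map⁻ (false ∷_) q
  ...   | _ , r , refl with ∈-map⁻ (true ∷_) r
  ...     | _ , t , refl = cong suc (singleton-size t) , inj₂ (Vec.there Vec.here)

  in-A : ∀ {S} → S ∈ₗ A → InBinom 2 2 S × fz ∈ proj₁ S × Meets core S
  in-A p with ∈-cartesianProduct-elim close-member pair-size p
  ... | (x-size , x0∈ , meets-x) , y-size = (x-size , y-size) , x0∈ , inj₁ (meets-core-X meets-x)

  in-B : ∀ {S} → S ∈ₗ B → InBinom 2 2 S × fz ∈ proj₁ S × Meets core S
  in-B p with ∈-cartesianProduct-elim far-member near-member p
  ... | (x-size , x0∈) , (y-size , meets-y) = (x-size , y-size) , x0∈ , inj₂ (meets-core-Y meets-y)

  in-star : ∀ {S} → S ∈ₗ A ++ B → fz ∈ proj₁ S × Meets core S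
  in-star p with ∈-++⁻ A p
  ... | inj₁ q = proj₂ (in-A q)
  ... | inj₂ q = proj₂ (in-B q)

  open StarPlusOne fz core (A ++ B) in-star

  family-sizes : All (InBinom 2 2) family
  family-sizes = (cong (suc ∘ suc) (∣⊥∣≡0 (2 + k)) , cong (suc ∘ suc) (∣⊥∣≡0 (2 + k)))
               ∷ AllP.++⁺ (All.tabulate (proj₁ ∘ in-A)) (All.tabulate (proj₁ ∘ in-B))

  -- A and B are separated by their X-parts: those of A contain x1 or x2.
  close#far : Disjoint (x0x1 ∷ x0x2 ∷ []) farPairs
  close#far (here refl , q) with ∈-map⁻ (λ s → true ∷ false ∷ false ∷ s) q
  ... | _ , _ , ()
  close#far (there (here refl) , q) with ∈-map⁻ (λ s → true ∷ false ∷ false ∷ s) q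
  ... | _ , _ , ()

  -- core avoids x0, so it is not in the star; A and B are duplicate-free products.
  family-unique : Unique family
  family-unique = unique (λ ()) (UniqueP.++⁺ A-unique B-unique (disjoint-cartesianProduct (pairs M) nearPairs close#far))
    where
    A-unique : Unique A
    A-unique = UniqueP.cartesianProduct⁺ (((λ ()) ∷ []) ∷ [] ∷ []) (pairs-unique M)
    B-unique : Unique B
    B-unique = UniqueP.cartesianProduct⁺
      (UniqueP.map⁺ (∷-injectiveʳ ∘ ∷-injectiveʳ ∘ ∷-injectiveʳ) (singletons-unique (1 + k)))
      (UniqueP.++⁺ (unique-map-cons true (singletons-unique (3 + k)))
                   (unique-map-cons false (unique-map-cons true (singletons-unique (2 + k))))
                   (disjoint-map-cons (singletons (3 + k)) _))

  family-intersecting : Intersecting family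
  family-intersecting = intersecting (inj₁ (meets-core-X {proj₁ core} (inj₁ (Vec.there Vec.here))))

  x0x3 y0y1 y2y3 : Subset M
  x0x3 = true ∷ false ∷ false ∷ true ∷ ⊥
  y0y1 = true ∷ true ∷ ⊥
  y2y3 = false ∷ false ∷ true ∷ true ∷ ⊥

  x0x3-y0y1∈B : (x0x3 , y0y1) ∈ₗ B
  x0x3-y0y1∈B = ∈-cartesianProduct⁺ {xs = farPairs} {ys = nearPairs} (here refl) (here refl)

  x0x1-y0y1∈A : (x0x1 , y0y1) ∈ₗ A
  x0x1-y0y1∈A = ∈-cartesianProduct⁺ {xs = x0x1 ∷ x0x2 ∷ []} (here refl) (∈-pairs-head (here refl))

  x0x1-y2y3∈A : (x0x1 , y2y3) ∈ₗ A
  x0x1-y2y3∈A = ∈-cartesianProduct⁺ {xs = x0x1 ∷ x0x2 ∷ []}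
    (here refl) (∈-pairs-tail (∈-pairs-tail (∈-pairs-head (here refl))))

  -- Both intersections vanish on the first four points and are ⊥ ∩ ⊥ beyond them.
  x-disjoint : Empty (proj₁ core ∩ x0x3)
  x-disjoint = empty-if-⊥ (cong (λ t → false ∷ false ∷ false ∷ false ∷ t) (∩-zeroˡ ⊥))

  y-disjoint : Empty (y0y1 ∩ y2y3)
  y-disjoint = empty-if-⊥ (cong (λ t → false ∷ false ∷ false ∷ false ∷ t) (∩-zeroˡ ⊥))

  family-two-sided : TwoSidedIntersecting family
  family-two-sided = family-intersecting
    , (core , (x0x3 , y0y1) , here refl , there (∈-++⁺ʳ A x0x3-y0y1∈B) , x-disjoint)
    , ((x0x1 , y0y1) , (x0x1 , y2y3) , there (∈-++⁺ˡ x0x1-y0y1∈A) , there (∈-++⁺ˡ x0x1-y2y3∈A) , y-disjoint)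

  family-length : length family ≡ suc (2 * length (pairs M) + (1 + k) * ((3 + k) + (2 + k)))
  family-length = cong suc (trans (length-++ A)
    (cong₂ _+_ (length-cartesianProduct (x0x1 ∷ x0x2 ∷ []) (pairs M))
               (trans (length-cartesianProduct farPairs nearPairs) (cong₂ _*_ far-length near-length))))
    where
    far-length : length farPairs ≡ 1 + k
    far-length = trans (length-map _ (singletons (1 + k))) (singletons-length (1 + k))
    near-length : length nearPairs ≡ (3 + k) + (2 + k)
    near-length = trans (length-++ (map (true ∷_) (singletons (3 + k))))
      (cong₂ _+_ (trans (length-map (true ∷_) (singletons (3 + k))) (singletons-length (3 + k)))
                 (trans (length-map (false ∷_) (map (true ∷_) (singletons (2 + k))))
                        (trans (length-map (true ∷_) (singletons (2 + k))) (singletons-length (2 + k)))))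

family-size-identity : ∀ k p → 2 * p + (4 + k) ≡ (4 + k) * (4 + k) →
  3 * (4 + k) * (4 + k) + 10 ≡ suc (2 * p + (1 + k) * ((3 + k) + (2 + k))) + 10 * (4 + k)
family-size-identity k p pairs-count = begin
  3 * (4 + k) * (4 + k) + 10               ≡⟨ split-square k ⟩
  (4 + k) * (4 + k) + R                    ≡⟨ cong (_+ R) (sym pairs-count) ⟩
  (2 * p + (4 + k)) + R                    ≡⟨ regroup k p ⟩
  suc (2 * p + (1 + k) * ((3 + k) + (2 + k))) + 10 * (4 + k) ∎
  where
  open ≡-Reasoning
  R = 2 * (4 + k) * (4 + k) + 10
  split-square : ∀ k → 3 * (4 + k) * (4 + k) + 10 ≡ (4 + k) * (4 + k) + (2 * (4 + k) * (4 + k) + 10)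
  split-square = solve-∀
  regroup : ∀ k p → (2 * p + (4 + k)) + (2 * (4 + k) * (4 + k) + 10)
                  ≡ suc (2 * p + (1 + k) * ((3 + k) + (2 + k))) + 10 * (4 + k)
  regroup = solve-∀

mainTheorem1 : (m : ℕ) → 5 ≤ m →
    Σ[ 𝓕 ∈ List (BiSet m) ]
    ( Unique 𝓕
    × All (InBinom 2 2) 𝓕
    × TwoSidedIntersecting 𝓕
    × 3 * m * m + 10 ≤ length 𝓕 + 10 * m )
mainTheorem1 (suc (suc (suc (suc k)))) _ =
  family , family-unique , family-sizes , family-two-sided ,
  ≤-reflexive (trans (family-size-identity k (length (pairs M)) (pairs-length M))
                     (cong (_+ 10 * M) (sym family-length)))
  where open Construction k
mainTheorem1 0 ()
mainTheorem1 1 (s≤s ())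
mainTheorem1 2 (s≤s (s≤s ()))
mainTheorem1 3 (s≤s (s≤s (s≤s ())))
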